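{- Let $(T_0,D_0,T_1,D_1,\dots,T_n,D_n)$ be a ring of bowties in an internally $4$-connected binary matroid $M$, where $T_i=\{a_i,b_i,c_i\}$. Then (i) $\{b_0,b_1,\dots,b_n\}$ is either a circuit or an independent set of $M$; and (ii) $M\backslash c_0,c_1,\dots,c_n\cong M\backslash a_0,a_1,\dots,a_n$.
   Context: A triangle is a $3$-element circuit, a triad a $3$-element cocircuit; $M$ is internally $4$-connected if it is $3$-connected and for every $3$-separation $(X,Y)$ one of $X,Y$ is a triangle or a triad. For $n\ge2$, a ring of bowties $(T_0,D_0,\dots,T_n,D_n)$ consists of distinct elements $a_i,b_i,c_i$ ($0\le i\le n$) with each $T_i=\{a_i,b_i,c_i\}$ a triangle, each $D_j=\{b_j,c_j,a_{j+1},b_{j+1}\}$ ($0\le j\le n-1$) a cocircuit, and $D_n=\{b_n,c_n,a_0,b_0\}$ a cocircuit. -}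

module Defs where

open import Data.Nat using (ℕ; zero; suc; _+_; _<_; _≤_; _⊔_)
open import Data.Nat.DivMod using (_%_; m%n<n)
open import Data.Bool using (Bool; true; false; _∧_; _xor_; if_then_else_)
open import Data.Fin using (Fin; zero; suc; toℕ; fromℕ<; _≟_)
open import Data.Fin.Subset using (Subset; _∈_; _∉_; _⊆_; _⊂_; _∩_; _∪_; ∁; ⁅_⁆; ∣_∣; ⊥; ⊤; Nonempty)
open import Data.Vec using (Vec; []; _∷_; replicate; tabulate; zipWith; foldr)
import Data.Vec as Vec
open import Data.List using (List; []; _∷_; _++_; allFin)
open import Data.Bool.ListAction using (any)
import Data.List as List
open import Data.Product using (Σ; ∃; _×_; _,_)
open import Data.Sum using (_⊎_)
open import Relation.Nullary using (¬_)
open import Relation.Nullary.Decidable using (⌊_⌋)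
open import Relation.Binary.PropositionalEquality using (_≡_; _≢_)
open import Function.Bundles using (_⇔_)

record Matroid (m : ℕ) : Set where
  field
    indep   : Subset m → Bool
    I1      : indep ⊥ ≡ true
    I2      : ∀ X Y → Y ⊆ X → indep X ≡ true → indep Y ≡ true
    I3      : ∀ X Y → indep X ≡ true → indep Y ≡ true → ∣ X ∣ < ∣ Y ∣ →
              ∃ λ e → e ∈ Y × e ∉ X × indep (X ∪ ⁅ e ⁆) ≡ true

open Matroid public

Independent : ∀ {m} → Matroid m → Subset m → Set
Independent M X = indep M X ≡ true

Dependent : ∀ {m} → Matroid m → Subset m → Set
Dependent M X = indep M X ≡ false

Circuit : ∀ {m} → Matroid m → Subset m → Set
Circuit M C = Dependent M C × (∀ Y → Y ⊂ C → Independent M Y)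

Basis : ∀ {m} → Matroid m → Subset m → Set
Basis M B = Independent M B × (∀ e → e ∉ B → Dependent M (B ∪ ⁅ e ⁆))

MeetsEveryBasis : ∀ {m} → Matroid m → Subset m → Set
MeetsEveryBasis M D = ∀ B → Basis M B → Nonempty (D ∩ B)

Cocircuit : ∀ {m} → Matroid m → Subset m → Set
Cocircuit M D = MeetsEveryBasis M D × (∀ Y → Y ⊂ D → ¬ MeetsEveryBasis M Y)

Triangle : ∀ {m} → Matroid m → Subset m → Set
Triangle M X = Circuit M X × ∣ X ∣ ≡ 3

Triad : ∀ {m} → Matroid m → Subset m → Set
Triad M X = Cocircuit M X × ∣ X ∣ ≡ 3

allSubsets : ∀ m → List (Subset m)
allSubsets zero    = [] ∷ []
allSubsets (suc m) = List.map (true ∷_) (allSubsets m) ++ List.map (false ∷_) (allSubsets m)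

rank : ∀ {m} → Matroid m → Subset m → ℕ
rank {m} M X =
  List.foldr _⊔_ 0
    (List.map (λ Y → if indep M (Y ∩ X) then ∣ Y ∩ X ∣ else 0) (allSubsets m))

Separation : ∀ {m} → Matroid m → ℕ → Subset m → Set
Separation M k X =
  k ≤ ∣ X ∣ × k ≤ ∣ ∁ X ∣ × rank M X + rank M (∁ X) < rank M ⊤ + k

ThreeConnected : ∀ {m} → Matroid m → Set
ThreeConnected M = ∀ X → ¬ Separation M 1 X × ¬ Separation M 2 X

InternallyFourConnected : ∀ {m} → Matroid m → Set
InternallyFourConnected M =
  ThreeConnected M ×
  (∀ X → Separation M 3 X →
     Triangle M X ⊎ Triad M X ⊎ Triangle M (∁ X) ⊎ Triad M (∁ X))

columnSum : ∀ {r m} → Vec (Vec Bool m) r → Subset m → Vec Bool r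
columnSum A Z = Vec.map (λ row → foldr _ _xor_ false (zipWith _∧_ row Z)) A

-- the columns of A indexed by X are linearly independent over GF(2):
-- the only GF(2)-combination (= subset Z of X) summing to 0 is trivial
LinIndepCols : ∀ {r m} → Vec (Vec Bool m) r → Subset m → Set
LinIndepCols {r} A X = ∀ Z → Z ⊆ X → columnSum A Z ≡ replicate r false → Z ≡ ⊥

Binary : ∀ {m} → Matroid m → Set
Binary {m} M = ∃ λ r → Σ (Vec (Vec Bool m) r) λ A →
  ∀ X → Independent M X ⇔ LinIndepCols A X

next : ∀ {n} → Fin (suc n) → Fin (suc n)
next {n} i = fromℕ< (m%n<n (suc (toℕ i)) (suc n))

imageSet : ∀ {k m} → (Fin k → Fin m) → Subset m
imageSet {k} f = tabulate λ e → any (λ i → ⌊ f i ≟ e ⌋) (allFin k)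

set3 : ∀ {m} → Fin m → Fin m → Fin m → Subset m
set3 x y z = ⁅ x ⁆ ∪ ⁅ y ⁆ ∪ ⁅ z ⁆

set4 : ∀ {m} → Fin m → Fin m → Fin m → Fin m → Subset m
set4 w x y z = ⁅ w ⁆ ∪ ⁅ x ⁆ ∪ ⁅ y ⁆ ∪ ⁅ z ⁆

RingOfBowties : ∀ {m} → Matroid m → (n : ℕ) → (a b c : Fin (suc n) → Fin m) → Set
RingOfBowties M n a b c =
  2 ≤ n ×
  (∀ i j → a i ≡ a j → i ≡ j) × (∀ i j → b i ≡ b j → i ≡ j) ×
  (∀ i j → c i ≡ c j → i ≡ j) ×
  (∀ i j → a i ≢ b j) × (∀ i j → a i ≢ c j) × (∀ i j → b i ≢ c j) ×
  (∀ i → Triangle M (set3 (a i) (b i) (c i))) ×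
  -- D_j = {b_j, c_j, a_{j+1}, b_{j+1}} cocircuits (indices mod n+1)
  (∀ j → Cocircuit M (set4 (b j) (c j) (a (next j)) (b (next j))))

-- Isomorphism of deletions M\X ≅ M\Y.
-- M\X has ground set E - X and its independent sets are the
-- independent sets of M contained in E - X.

image : ∀ {m} → (Fin m → Fin m) → Subset m → Subset m
image {m} φ Z = tabulate λ f → any (λ e → Vec.lookup Z e ∧ ⌊ φ e ≟ f ⌋) (allFin m)

DeletionIso : ∀ {m} → Matroid m → Subset m → Subset m → Set
DeletionIso {m} M X Y = Σ (Fin m → Fin m) λ φ →
  (∀ e → e ∉ X → φ e ∉ Y) ×
  (∀ e e' → e ∉ X → e' ∉ X → φ e ≡ φ e' → e ≡ e') ×
  (∀ f → f ∉ Y → ∃ λ e → e ∉ X × φ e ≡ f) ×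
  (∀ Z → Z ⊆ ∁ X → indep M Z ≡ indep M (image φ Z))

-- Fix a GF(2)-representation A of M. Call Z a cycle when its columns sum to zero; then Z is
-- independent exactly when it contains no nonempty cycle. The heart of the matter is
-- orthogonality: a cocircuit D meets every cycle in an even number of elements. Indeed, for
-- e ∈ D the minimality of D provides a basis B with B ∩ D = {e}, and basis exchange shows
-- that the column of x involves the basis element e exactly when x ∈ D; summing over a
-- cycle Z, the parity of |Z ∩ D| is the e-coordinate of the zero vector.
--
-- (i) A cycle Z ⊆ {b₀,…,bₙ} meets D_j only in b_j and b_{j+1}, so it contains both or
-- neither; going round the ring, Z is empty or everything, and every proper subset of
-- {b₀,…,bₙ} is independent.
--
-- (ii) The bijection a_i ↦ c_i, c_i ↦ a_i, b_i ↦ b_{i+1} carries a cycle U avoiding the c_i to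
-- U + Σ {T_i : a_i ∈ U}: orthogonality with D_{i-1} accounts for the b_i. This is again a
-- cycle, now avoiding the a_i, and the inverse map behaves symmetrically, so the two
-- deletions have the same independent sets up to the bijection.

module Submission where

open import Algebra.Bundles using (CommutativeRing)
open import Data.Bool using (Bool; true; false; T; _∧_; _∨_; _xor_)
import Data.Bool as Bool
open import Data.Bool.ListAction using (any)
open import Data.Bool.Properties
  using (T-≡; T-∧; xor-assoc; xor-comm; xor-identityˡ; xor-identityʳ; xor-same; xor-∧-commutativeRing;
         ∧-comm; ∧-distribˡ-xor; ∧-identityʳ; ∧-zeroʳ)
open import Data.Empty using (⊥-elim)
open import Data.Fin using (Fin; zero; suc; _≟_; toℕ; fromℕ; inject₁)
open import Data.Fin.Properties using (all?; any?; toℕ-injective; toℕ-fromℕ<; toℕ-fromℕ; toℕ-inject₁; toℕ<n)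
open import Data.Fin.Relation.Unary.Top using (view; ‵fromℕ; ‵inject₁)
open import Data.Fin.Subset using (Subset; _-_; _∈_; _∉_; _⊆_; _⊂_; _∩_; _∪_; ∁; ⁅_⁆; ⊥; Nonempty)
open import Data.Fin.Subset.Properties
  using (_∈?_; _⊆?_; anySubset?; nonempty?; Empty-unique; ⊆-antisym; ∉⊥; x∈⁅x⁆; x∈⁅y⁆⇒x≡y; x∈⁅y⁆⇔x≡y;
         x≢y⇒x∉⁅y⁆; x∈p∪q⁺; x∈p∪q⁻; p⊆p∪q; q⊆p∪q; x∈p∩q⁺; x∈p∩q⁻; x∉p⇒x∈∁p; x∈∁p⇒x∉p;
         p─q⊆p; x∈p∧x≢y⇒x∈p-y; x∈p⇒p-x⊂p)
open import Data.List using (allFin)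
open import Data.List.Membership.Propositional using (lose)
open import Data.List.Membership.Propositional.Properties using (∈-allFin)
open import Data.List.Relation.Unary.Any using (satisfied)
open import Data.List.Relation.Unary.Any.Properties using (any⁺; any⁻)
open import Data.Nat using (ℕ; zero; suc; _≤_; s≤s; z≤n)
open import Data.Nat.DivMod using (_%_; m<n⇒m%n≡m; n%n≡0)
open import Data.Nat.Properties using (0≢1+n; 1+n≢n; ≤-trans)
open import Data.Product using (∃; _×_; _,_; proj₁; proj₂)
open import Data.Sum using (_⊎_; inj₁; inj₂; [_,_]′)
open import Data.Vec using (Vec; there; []; _∷_; replicate; zipWith; foldr; tabulate; lookup)
import Data.Vec as Vec
open import Data.Vec.Properties
  using (≡-dec; []=⇒lookup; lookup⇒[]=; lookup-map; lookup-replicate; lookup-zipWith; lookup∘tabulate;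
         map-id; tabulate∘lookup; tabulate-cong; zipWith-assoc; zipWith-comm; zipWith-identityˡ; zipWith-identityʳ)
open import Defs
open import Function using (_∘_; id)
open import Function.Bundles using (_⇔_; mk⇔; Equivalence)
open import Function.Properties.Equivalence using () renaming (trans to ⇔-trans; sym to ⇔-sym)
open import Relation.Binary.PropositionalEquality
  using (_≡_; _≢_; refl; sym; trans; cong; cong₂; subst; subst₂; module ≡-Reasoning)
open import Relation.Nullary using (¬_; ¬?; Dec; yes; no; _×-dec_; _→-dec_)
open import Relation.Nullary.Decidable using (⌊_⌋; decidable-stable; toWitness; fromWitness)

open import Algebra.Properties.CommutativeSemigroup (CommutativeRing.+-commutativeSemigroup xor-∧-commutativeRing)
  using () renaming (interchange to xor-interchange)

open ≡-Reasoning

private variable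
  k m n : ℕ

≡true⇔≡true⇒≡ : ∀ {x y} → x ≡ true ⇔ y ≡ true → x ≡ y
≡true⇔≡true⇒≡ {true}  x⇔y = sym (Equivalence.to x⇔y refl)
≡true⇔≡true⇒≡ {false} {false} x⇔y = refl
≡true⇔≡true⇒≡ {false} {true}  x⇔y = Equivalence.from x⇔y refl

xor≡false⇒≡ : ∀ {x y} → x xor y ≡ false → x ≡ y
xor≡false⇒≡ {false} {false} _ = refl
xor≡false⇒≡ {true}  {true}  _ = refl

infixr 6 _⊕_
infix 7 _·_

_⊕_ : Vec Bool n → Vec Bool n → Vec Bool n
_⊕_ = zipWith _xor_

-- u · v is the parity of |u ∩ v|; the ρ-th entry of columnSum A Z is (row ρ of A) · Z.
_·_ : Vec Bool n → Vec Bool n → Bool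
u · v = foldr _ _xor_ false (zipWith _∧_ u v)

𝟎 : Vec Bool n
𝟎 = replicate _ false

lookup-ext : ∀ {A : Set} {u v : Vec A n} → (∀ i → lookup u i ≡ lookup v i) → u ≡ v
lookup-ext {u = u} {v} eq = begin
  u                     ≡⟨ tabulate∘lookup u ⟨
  tabulate (lookup u)   ≡⟨ tabulate-cong eq ⟩
  tabulate (lookup v)   ≡⟨ tabulate∘lookup v ⟩
  v                     ∎

lookup-⊕ : ∀ (u v : Vec Bool n) i → lookup (u ⊕ v) i ≡ lookup u i xor lookup v i
lookup-⊕ u v i = lookup-zipWith _xor_ i u v

⊕-assoc : ∀ (u v w : Vec Bool n) → (u ⊕ v) ⊕ w ≡ u ⊕ (v ⊕ w)
⊕-assoc = zipWith-assoc xor-assoc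

⊕-comm : ∀ (u v : Vec Bool n) → u ⊕ v ≡ v ⊕ u
⊕-comm = zipWith-comm xor-comm

⊕-identityˡ : ∀ (u : Vec Bool n) → 𝟎 ⊕ u ≡ u
⊕-identityˡ = zipWith-identityˡ xor-identityˡ

⊕-identityʳ : ∀ (u : Vec Bool n) → u ⊕ 𝟎 ≡ u
⊕-identityʳ = zipWith-identityʳ xor-identityʳ

⊕-self : ∀ (u : Vec Bool n) → u ⊕ u ≡ 𝟎
⊕-self u = lookup-ext λ i → trans (lookup-⊕ u u i) (trans (xor-same (lookup u i)) (sym (lookup-replicate i false)))

⊕≡𝟎⇒≡ : ∀ {u v : Vec Bool n} → u ⊕ v ≡ 𝟎 → u ≡ v
⊕≡𝟎⇒≡ {u = u} {v} eq = begin
  u             ≡⟨ ⊕-identityʳ u ⟨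
  u ⊕ 𝟎         ≡⟨ cong (u ⊕_) (⊕-self v) ⟨
  u ⊕ (v ⊕ v)   ≡⟨ ⊕-assoc u v v ⟨
  (u ⊕ v) ⊕ v   ≡⟨ cong (_⊕ v) eq ⟩
  𝟎 ⊕ v         ≡⟨ ⊕-identityˡ v ⟩
  v             ∎

·-comm : ∀ (u v : Vec Bool n) → u · v ≡ v · u
·-comm u v = cong (foldr _ _xor_ false) (zipWith-comm ∧-comm u v)

·-𝟎ʳ : ∀ (u : Vec Bool n) → u · 𝟎 ≡ false
·-𝟎ʳ []      = refl
·-𝟎ʳ (x ∷ u) = cong₂ _xor_ (∧-zeroʳ x) (·-𝟎ʳ u)

·-⊕ʳ : ∀ (u v w : Vec Bool n) → u · (v ⊕ w) ≡ u · v xor u · w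
·-⊕ʳ []      []      []      = refl
·-⊕ʳ (x ∷ u) (y ∷ v) (z ∷ w) = begin
  (x ∧ (y xor z)) xor u · (v ⊕ w)               ≡⟨ cong₂ _xor_ (∧-distribˡ-xor x y z) (·-⊕ʳ u v w) ⟩
  ((x ∧ y) xor (x ∧ z)) xor (u · v xor u · w)   ≡⟨ xor-interchange (x ∧ y) (x ∧ z) (u · v) (u · w) ⟩
  ((x ∧ y) xor u · v) xor ((x ∧ z) xor u · w)   ∎

·-scaleʳ : ∀ z (u v : Vec Bool n) → u · Vec.map (z ∧_) v ≡ z ∧ u · v
·-scaleʳ false u v = trans (cong (u ·_) (map-false v)) (·-𝟎ʳ u)
  where map-false : ∀ {n} (v : Vec Bool n) → Vec.map (false ∧_) v ≡ 𝟎
        map-false []      = refl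
        map-false (_ ∷ v) = cong (false ∷_) (map-false v)
·-scaleʳ true u v = cong (u ·_) (map-id v)

·-⁅⁆ʳ : ∀ (u : Vec Bool n) i → u · ⁅ i ⁆ ≡ lookup u i
·-⁅⁆ʳ (x ∷ u) zero    = trans (cong₂ _xor_ (∧-identityʳ x) (·-𝟎ʳ u)) (xor-identityʳ x)
·-⁅⁆ʳ (x ∷ u) (suc i) = cong₂ _xor_ (∧-zeroʳ x) (·-⁅⁆ʳ u i)

·-false : ∀ (u v : Vec Bool n) → (∀ i → lookup u i ≡ true → lookup v i ≡ false) → u · v ≡ false
·-false []          []      _   = refl
·-false (false ∷ u) (_ ∷ v) dis = ·-false u v (dis ∘ suc)
·-false (true ∷ u)  (y ∷ v) dis = cong₂ _xor_ (dis zero refl) (·-false u v (dis ∘ suc))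

·-true⇒∃ : ∀ (u v : Vec Bool n) → u · v ≡ true → ∃ λ i → lookup u i ≡ true × lookup v i ≡ true
·-true⇒∃ []          []          ()
·-true⇒∃ (true ∷ u)  (true ∷ v)  _  = zero , refl , refl
·-true⇒∃ (true ∷ u)  (false ∷ v) uv = let i , p = ·-true⇒∃ u v uv in suc i , p
·-true⇒∃ (false ∷ u) (y ∷ v)     uv = let i , p = ·-true⇒∃ u v uv in suc i , p

combine : Vec Bool k → (Fin k → Vec Bool n) → Vec Bool n
combine []      Y = 𝟎
combine (z ∷ Z) Y = Vec.map (z ∧_) (Y zero) ⊕ combine Z (Y ∘ suc)

·-combine : ∀ (u : Vec Bool n) (Z : Vec Bool k) Y → u · combine Z Y ≡ Z · tabulate (λ w → u · Y w)
·-combine u []      Y = ·-𝟎ʳ u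
·-combine u (z ∷ Z) Y = begin
  u · (Vec.map (z ∧_) (Y zero) ⊕ combine Z (Y ∘ suc))       ≡⟨ ·-⊕ʳ u _ _ ⟩
  u · Vec.map (z ∧_) (Y zero) xor u · combine Z (Y ∘ suc)   ≡⟨ cong₂ _xor_ (·-scaleʳ z u (Y zero)) (·-combine u Z (Y ∘ suc)) ⟩
  (z ∧ u · Y zero) xor Z · tabulate (λ w → u · Y (suc w))   ∎

lookup-combine : ∀ (Z : Vec Bool k) (Y : Fin k → Vec Bool n) e →
                 lookup (combine Z Y) e ≡ Z · tabulate (λ w → lookup (Y w) e)
lookup-combine Z Y e = begin
  lookup (combine Z Y) e                ≡⟨ ·-⁅⁆ʳ (combine Z Y) e ⟨
  combine Z Y · ⁅ e ⁆                   ≡⟨ ·-comm (combine Z Y) ⁅ e ⁆ ⟩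
  ⁅ e ⁆ · combine Z Y                   ≡⟨ ·-combine ⁅ e ⁆ Z Y ⟩
  Z · tabulate (λ w → ⁅ e ⁆ · Y w)      ≡⟨ cong (Z ·_) (tabulate-cong λ w → trans (·-comm ⁅ e ⁆ (Y w)) (·-⁅⁆ʳ (Y w) e)) ⟩
  Z · tabulate (λ w → lookup (Y w) e)   ∎

combine-cong : ∀ (Z : Vec Bool k) {Y Y′ : Fin k → Vec Bool n} → (∀ w → Y w ≡ Y′ w) → combine Z Y ≡ combine Z Y′
combine-cong []      eq = refl
combine-cong (z ∷ Z) eq = cong₂ (λ u v → Vec.map (z ∧_) u ⊕ v) (eq zero) (combine-cong Z (eq ∘ suc))

combine-𝟎 : ∀ (Z : Vec Bool k) → combine {n = n} Z (λ _ → 𝟎) ≡ 𝟎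
combine-𝟎 Z = lookup-ext λ e → begin
  lookup (combine Z (λ _ → 𝟎)) e       ≡⟨ lookup-combine Z (λ _ → 𝟎) e ⟩
  Z · tabulate (λ _ → lookup 𝟎 e)      ≡⟨ ·-false Z _ (λ w _ → trans (lookup∘tabulate _ w) (lookup-replicate e false)) ⟩
  false                                ≡⟨ lookup-replicate e false ⟨
  lookup 𝟎 e                           ∎

∈⇒lookup : ∀ {x : Fin n} {p} → x ∈ p → lookup p x ≡ true
∈⇒lookup = []=⇒lookup

lookup⇒∈ : ∀ {x : Fin n} {p} → lookup p x ≡ true → x ∈ p
lookup⇒∈ {x = x} {p} = lookup⇒[]= x p

∉⇒lookup : ∀ {x : Fin n} {p} → x ∉ p → lookup p x ≡ false
∉⇒lookup {x = x} {p} x∉p with lookup p x in eq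
... | true  = ⊥-elim (x∉p (lookup⇒∈ eq))
... | false = refl

lookup⇒∉ : ∀ {x : Fin n} {p} → lookup p x ≡ false → x ∉ p
lookup⇒∉ eq x∈p = true≢false (trans (sym (∈⇒lookup x∈p)) eq)
  where true≢false : true ≢ false
        true≢false ()

∈⇔∈⇒lookup≡ : ∀ {x : Fin n} {y : Fin k} {p q} → x ∈ p ⇔ y ∈ q → lookup p x ≡ lookup q y
∈⇔∈⇒lookup≡ x⇔y = ≡true⇔≡true⇒≡ (mk⇔ (∈⇒lookup ∘ Equivalence.to x⇔y ∘ lookup⇒∈) (∈⇒lookup ∘ Equivalence.from x⇔y ∘ lookup⇒∈))

x∈p⊕q⁻ : ∀ {x : Fin n} p q → x ∈ p ⊕ q → x ∈ p ⊎ x ∈ q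
x∈p⊕q⁻ {x = x} p q x∈ with lookup p x in px | lookup q x in qx | trans (sym (lookup-⊕ p q x)) (∈⇒lookup x∈)
... | true  | _    | _ = inj₁ (lookup⇒∈ px)
... | false | true | _ = inj₂ (lookup⇒∈ qx)

x∈p∧x∉q⇒x∈p⊕q : ∀ {x : Fin n} p q → x ∈ p → x ∉ q → x ∈ p ⊕ q
x∈p∧x∉q⇒x∈p⊕q {x = x} p q x∈p x∉q =
  lookup⇒∈ (trans (lookup-⊕ p q x) (cong₂ _xor_ (∈⇒lookup x∈p) (∉⇒lookup x∉q)))

x∉p∧x∈q⇒x∈p⊕q : ∀ {x : Fin n} p q → x ∉ p → x ∈ q → x ∈ p ⊕ q
x∉p∧x∈q⇒x∈p⊕q p q x∉p x∈q = subst (_ ∈_) (⊕-comm q p) (x∈p∧x∉q⇒x∈p⊕q q p x∈q x∉p)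

x∈p∧x∈q⇒x∉p⊕q : ∀ {x : Fin n} p q → x ∈ p → x ∈ q → x ∉ p ⊕ q
x∈p∧x∈q⇒x∉p⊕q {x = x} p q x∈p x∈q =
  lookup⇒∉ (trans (lookup-⊕ p q x) (cong₂ _xor_ (∈⇒lookup x∈p) (∈⇒lookup x∈q)))

x∉p∧x∉q⇒x∉p⊕q : ∀ {x : Fin n} {p q} → x ∉ p → x ∉ q → x ∉ p ⊕ q
x∉p∧x∉q⇒x∉p⊕q {p = p} {q} x∉p x∉q x∈ = [ x∉p , x∉q ]′ (x∈p⊕q⁻ p q x∈)

⊕-⊆ : ∀ {p q s : Subset n} → p ⊆ s → q ⊆ s → p ⊕ q ⊆ s
⊕-⊆ {p = p} {q} p⊆s q⊆s x∈ = [ p⊆s , q⊆s ]′ (x∈p⊕q⁻ p q x∈)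

∈∪⁅⁆⇒∈ : ∀ {S : Subset n} {x f} → f ∈ S ∪ ⁅ x ⁆ → f ≢ x → f ∈ S
∈∪⁅⁆⇒∈ {S = S} {x} f∈ f≢x with x∈p∪q⁻ S ⁅ x ⁆ f∈
... | inj₁ f∈S = f∈S
... | inj₂ f∈x = ⊥-elim (f≢x (x∈⁅y⁆⇒x≡y x f∈x))

⊆-∪⁅⁆⇒⊆ : ∀ {Z S : Subset n} {x} → Z ⊆ S ∪ ⁅ x ⁆ → x ∉ Z → Z ⊆ S
⊆-∪⁅⁆⇒⊆ Z⊆ x∉Z f∈Z = ∈∪⁅⁆⇒∈ (Z⊆ f∈Z) λ { refl → x∉Z f∈Z }

⊕⁅⁆-⊆ : ∀ {Z S : Subset n} {x} → Z ⊆ S ∪ ⁅ x ⁆ → x ∈ Z → Z ⊕ ⁅ x ⁆ ⊆ S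
⊕⁅⁆-⊆ {Z = Z} {x = x} Z⊆ x∈Z {f} f∈ with f ≟ x | x∈p⊕q⁻ Z ⁅ x ⁆ f∈
... | yes refl | _         = ⊥-elim (x∈p∧x∈q⇒x∉p⊕q Z ⁅ x ⁆ x∈Z (x∈⁅x⁆ x) f∈)
... | no  f≢x  | inj₁ f∈Z = ∈∪⁅⁆⇒∈ (Z⊆ f∈Z) f≢x
... | no  f≢x  | inj₂ f∈x = ⊥-elim (f≢x (x∈⁅y⁆⇒x≡y x f∈x))

x∉p-x : ∀ (p : Subset n) x → x ∉ p - x
x∉p-x (_ ∷ p) zero    ()
x∉p-x (_ ∷ p) (suc x) (there x∈) = x∉p-x p x x∈

singleton-⊆ : ∀ {x : Fin n} {p} → x ∈ p → ⁅ x ⁆ ⊆ p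
singleton-⊆ {x = x} {p} x∈p f∈x = subst (_∈ p) (sym (x∈⁅y⁆⇒x≡y x f∈x)) x∈p

⊆∁⇒lookup : ∀ {U S : Subset n} {f} → U ⊆ ∁ S → f ∈ S → lookup U f ≡ false
⊆∁⇒lookup U⊆∁S f∈S = ∉⇒lookup λ f∈U → x∈∁p⇒x∉p (U⊆∁S f∈U) f∈S

combine-⊆ : ∀ {B : Subset n} (Z : Vec Bool k) Y → (∀ w → Y w ⊆ B) → combine Z Y ⊆ B
combine-⊆ {B = B} Z Y Y⊆B {x} x∈ with x ∈? B
... | yes x∈B = x∈B
... | no  x∉B = ⊥-elim (lookup⇒∉ (trans (lookup-combine Z Y x) (·-false Z _ outside)) x∈)
  where
  outside : ∀ w → lookup Z w ≡ true → lookup (tabulate (λ w → lookup (Y w) x)) w ≡ false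
  outside w _ = trans (lookup∘tabulate _ w) (∉⇒lookup (x∉B ∘ Y⊆B w))

⁅x⁆∪q≡⁅x⁆⊕q : ∀ {x : Fin n} {q} → x ∉ q → ⁅ x ⁆ ∪ q ≡ ⁅ x ⁆ ⊕ q
⁅x⁆∪q≡⁅x⁆⊕q {x = x} {q} x∉q = lookup-ext λ f → trans (lookup-zipWith _∨_ f ⁅ x ⁆ q) (trans (pointwise f) (sym (lookup-⊕ ⁅ x ⁆ q f)))
  where
  pointwise : ∀ f → lookup ⁅ x ⁆ f ∨ lookup q f ≡ lookup ⁅ x ⁆ f xor lookup q f
  pointwise f with f ≟ x
  ... | yes refl rewrite ∈⇒lookup (x∈⁅x⁆ x) | ∉⇒lookup x∉q = refl
  ... | no  f≢x  rewrite ∉⇒lookup (x≢y⇒x∉⁅y⁆ f≢x) = refl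

·-⁅⁆⊕ : ∀ (u : Subset n) x v → u · (⁅ x ⁆ ⊕ v) ≡ lookup u x xor u · v
·-⁅⁆⊕ u x v = trans (·-⊕ʳ u ⁅ x ⁆ v) (cong (_xor u · v) (·-⁅⁆ʳ u x))

·-set4 : ∀ (u : Subset n) {p q r s} → p ≢ q → p ≢ r → p ≢ s → q ≢ r → q ≢ s → r ≢ s →
         u · set4 p q r s ≡ lookup u p xor lookup u q xor lookup u r xor lookup u s
·-set4 u {p} {q} {r} {s} p≢q p≢r p≢s q≢r q≢s r≢s = begin
  u · (⁅ p ⁆ ∪ ⁅ q ⁆ ∪ ⁅ r ⁆ ∪ ⁅ s ⁆)                       ≡⟨ cong (λ t → u · (⁅ p ⁆ ∪ ⁅ q ⁆ ∪ t)) rs ⟩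
  u · (⁅ p ⁆ ∪ ⁅ q ⁆ ∪ ⁅ r ⁆ ⊕ ⁅ s ⁆)                       ≡⟨ cong (λ t → u · (⁅ p ⁆ ∪ t)) qrs ⟩
  u · (⁅ p ⁆ ∪ ⁅ q ⁆ ⊕ ⁅ r ⁆ ⊕ ⁅ s ⁆)                       ≡⟨ cong (u ·_) pqrs ⟩
  u · (⁅ p ⁆ ⊕ ⁅ q ⁆ ⊕ ⁅ r ⁆ ⊕ ⁅ s ⁆)                       ≡⟨ ·-⁅⁆⊕ u p _ ⟩
  lookup u p xor u · (⁅ q ⁆ ⊕ ⁅ r ⁆ ⊕ ⁅ s ⁆)                ≡⟨ cong (lookup u p xor_) (·-⁅⁆⊕ u q _) ⟩
  lookup u p xor lookup u q xor u · (⁅ r ⁆ ⊕ ⁅ s ⁆)         ≡⟨ cong (λ t → lookup u p xor lookup u q xor t) (·-⁅⁆⊕ u r _) ⟩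
  lookup u p xor lookup u q xor lookup u r xor u · ⁅ s ⁆    ≡⟨ cong (λ t → lookup u p xor lookup u q xor lookup u r xor t) (·-⁅⁆ʳ u s) ⟩
  lookup u p xor lookup u q xor lookup u r xor lookup u s   ∎
  where
  rs : ⁅ r ⁆ ∪ ⁅ s ⁆ ≡ ⁅ r ⁆ ⊕ ⁅ s ⁆
  rs = ⁅x⁆∪q≡⁅x⁆⊕q (x≢y⇒x∉⁅y⁆ r≢s)
  qrs : ⁅ q ⁆ ∪ ⁅ r ⁆ ⊕ ⁅ s ⁆ ≡ ⁅ q ⁆ ⊕ ⁅ r ⁆ ⊕ ⁅ s ⁆
  qrs = ⁅x⁆∪q≡⁅x⁆⊕q (x∉p∧x∉q⇒x∉p⊕q (x≢y⇒x∉⁅y⁆ q≢r) (x≢y⇒x∉⁅y⁆ q≢s))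
  pqrs : ⁅ p ⁆ ∪ ⁅ q ⁆ ⊕ ⁅ r ⁆ ⊕ ⁅ s ⁆ ≡ ⁅ p ⁆ ⊕ ⁅ q ⁆ ⊕ ⁅ r ⁆ ⊕ ⁅ s ⁆
  pqrs = ⁅x⁆∪q≡⁅x⁆⊕q (x∉p∧x∉q⇒x∉p⊕q (x≢y⇒x∉⁅y⁆ p≢q) (x∉p∧x∉q⇒x∉p⊕q (x≢y⇒x∉⁅y⁆ p≢r) (x≢y⇒x∉⁅y⁆ p≢s)))

set3-∈⁻ : ∀ {p q s f : Fin n} → f ∈ set3 p q s → p ≡ f ⊎ q ≡ f ⊎ s ≡ f
set3-∈⁻ {p = p} {q} {s} f∈ with x∈p∪q⁻ ⁅ p ⁆ (⁅ q ⁆ ∪ ⁅ s ⁆) f∈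
... | inj₁ f∈p  = inj₁ (sym (x∈⁅y⁆⇒x≡y p f∈p))
... | inj₂ f∈qs with x∈p∪q⁻ ⁅ q ⁆ ⁅ s ⁆ f∈qs
...   | inj₁ f∈q = inj₂ (inj₁ (sym (x∈⁅y⁆⇒x≡y q f∈q)))
...   | inj₂ f∈s = inj₂ (inj₂ (sym (x∈⁅y⁆⇒x≡y s f∈s)))

∈tabulate-any⇔ : ∀ {x : Fin n} (p : Fin n → Fin k → Bool) →
                 x ∈ tabulate (λ y → any (p y) (allFin k)) ⇔ ∃ λ i → T (p x i)
∈tabulate-any⇔ {k = k} {x = x} p = mk⇔
  (λ x∈ → satisfied (any⁻ (p x) (allFin k) (Equivalence.from T-≡ (trans (sym (lookup∘tabulate _ x)) (∈⇒lookup x∈)))))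
  (λ (i , pxi) → lookup⇒∈ (trans (lookup∘tabulate _ x) (Equivalence.to T-≡ (any⁺ (p x) (lose (∈-allFin i) pxi)))))

∈imageSet⇔ : ∀ {f : Fin k → Fin n} {e} → e ∈ imageSet f ⇔ ∃ λ i → f i ≡ e
∈imageSet⇔ {f = f} = mk⇔
  (λ e∈ → let i , fi≡e = Equivalence.to (∈tabulate-any⇔ λ e i → ⌊ f i ≟ e ⌋) e∈ in i , toWitness fi≡e)
  (λ (i , fi≡e) → Equivalence.from (∈tabulate-any⇔ λ e i → ⌊ f i ≟ e ⌋) (i , fromWitness fi≡e))

∈image⇔ : ∀ {φ : Fin n → Fin n} {Z f} → f ∈ image φ Z ⇔ ∃ λ e → e ∈ Z × φ e ≡ f
∈image⇔ {n = n} {φ = φ} {Z} = mk⇔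
  (λ f∈ → let e , t = Equivalence.to (∈tabulate-any⇔ p) f∈
              e∈Z , φe≡f = Equivalence.to T-∧ t
          in e , lookup⇒∈ (Equivalence.to T-≡ e∈Z) , toWitness φe≡f)
  (λ (e , e∈Z , φe≡f) → Equivalence.from (∈tabulate-any⇔ p)
     (e , Equivalence.from T-∧ (Equivalence.from T-≡ (∈⇒lookup e∈Z) , fromWitness φe≡f)))
  where
  p : Fin n → Fin n → Bool
  p f e = lookup Z e ∧ ⌊ φ e ≟ f ⌋

image-mono : ∀ {φ : Fin n → Fin n} {U V} → U ⊆ V → image φ U ⊆ image φ V
image-mono U⊆V f∈ = let e , e∈U , φe≡f = Equivalence.to ∈image⇔ f∈ in Equivalence.from ∈image⇔ (e , U⊆V e∈U , φe≡f)

image-⊥ : ∀ {φ : Fin n → Fin n} → image φ ⊥ ≡ ⊥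
image-⊥ = Empty-unique λ (f , f∈) → ∉⊥ (proj₁ (proj₂ (Equivalence.to ∈image⇔ f∈)))

image-avoids : ∀ {φ : Fin n → Fin n} {X Y U} → (∀ e → e ∉ X → φ e ∉ Y) → U ⊆ ∁ X → image φ U ⊆ ∁ Y
image-avoids {φ = φ} φ-avoids U⊆ f∈ with Equivalence.to (∈image⇔ {φ = φ}) f∈
... | e , e∈U , refl = x∉p⇒x∈∁p (φ-avoids e (x∈∁p⇒x∉p (U⊆ e∈U)))

Inverses : (Fin n → Fin n) → (Fin n → Fin n) → Set
Inverses φ ψ = (∀ e → ψ (φ e) ≡ e) × (∀ f → φ (ψ f) ≡ f)

∈image-inverse⇔ : ∀ {φ ψ : Fin n → Fin n} → Inverses φ ψ → ∀ {U f} → f ∈ image φ U ⇔ ψ f ∈ U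
∈image-inverse⇔ {φ = φ} {ψ} (ψ∘φ , φ∘ψ) {U} {f} = mk⇔
  (λ f∈ → let e , e∈U , φe≡f = Equivalence.to ∈image⇔ f∈ in subst (_∈ U) (trans (sym (ψ∘φ e)) (cong ψ φe≡f)) e∈U)
  (λ ψf∈U → Equivalence.from ∈image⇔ (ψ f , ψf∈U , φ∘ψ f))

image-inverse : ∀ {φ ψ : Fin n → Fin n} → Inverses φ ψ → ∀ U → image ψ (image φ U) ≡ U
image-inverse {φ = φ} {ψ} inv@(ψ∘φ , φ∘ψ) U = ⊆-antisym
  (λ {f} f∈ → subst (_∈ U) (ψ∘φ f) (Equivalence.to (∈image-inverse⇔ inv) (Equivalence.to (∈image-inverse⇔ inv⁻¹) f∈)))
  (λ {f} f∈U → Equivalence.from (∈image-inverse⇔ inv⁻¹) (Equivalence.from (∈image-inverse⇔ inv) (subst (_∈ U) (sym (ψ∘φ f)) f∈U)))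
  where
  inv⁻¹ : Inverses ψ φ
  inv⁻¹ = φ∘ψ , ψ∘φ

-- Column sums and linear independence

module _ {r} (A : Vec (Vec Bool m) r) where

  Cycle : Subset m → Set
  Cycle Z = columnSum A Z ≡ 𝟎

  Represents : Subset m → Fin m → Subset m → Set
  Represents B x Y = Y ⊆ B × columnSum A Y ≡ columnSum A ⁅ x ⁆

  Spans : Subset m → Set
  Spans B = ∀ x → ∃ (Represents B x)

  lookup-columnSum : ∀ Z ρ → lookup (columnSum A Z) ρ ≡ lookup A ρ · Z
  lookup-columnSum Z ρ = lookup-map ρ (_· Z) A

  columnSum-⊕ : ∀ X Y → columnSum A (X ⊕ Y) ≡ columnSum A X ⊕ columnSum A Y
  columnSum-⊕ X Y = lookup-ext λ ρ → begin
    lookup (columnSum A (X ⊕ Y)) ρ                          ≡⟨ lookup-columnSum (X ⊕ Y) ρ ⟩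
    lookup A ρ · (X ⊕ Y)                                    ≡⟨ ·-⊕ʳ (lookup A ρ) X Y ⟩
    lookup A ρ · X xor lookup A ρ · Y                       ≡⟨ cong₂ _xor_ (lookup-columnSum X ρ) (lookup-columnSum Y ρ) ⟨
    lookup (columnSum A X) ρ xor lookup (columnSum A Y) ρ   ≡⟨ lookup-⊕ (columnSum A X) (columnSum A Y) ρ ⟨
    lookup (columnSum A X ⊕ columnSum A Y) ρ                ∎

  columnSum-combine : ∀ (Z : Vec Bool k) Y → columnSum A (combine Z Y) ≡ combine Z (columnSum A ∘ Y)
  columnSum-combine Z Y = lookup-ext λ ρ → begin
    lookup (columnSum A (combine Z Y)) ρ                    ≡⟨ lookup-columnSum (combine Z Y) ρ ⟩
    lookup A ρ · combine Z Y                                ≡⟨ ·-combine (lookup A ρ) Z Y ⟩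
    Z · tabulate (λ w → lookup A ρ · Y w)                   ≡⟨ cong (Z ·_) (tabulate-cong λ w → lookup-columnSum (Y w) ρ) ⟨
    Z · tabulate (λ w → lookup (columnSum A (Y w)) ρ)       ≡⟨ lookup-combine Z (columnSum A ∘ Y) ρ ⟨
    lookup (combine Z (columnSum A ∘ Y)) ρ                  ∎

  columnSum-expand : ∀ Z → columnSum A Z ≡ combine Z (λ w → columnSum A ⁅ w ⁆)
  columnSum-expand Z = lookup-ext λ ρ → begin
    lookup (columnSum A Z) ρ                                ≡⟨ lookup-columnSum Z ρ ⟩
    lookup A ρ · Z                                          ≡⟨ ·-comm (lookup A ρ) Z ⟩
    Z · lookup A ρ                                          ≡⟨ cong (Z ·_) (tabulate∘lookup (lookup A ρ)) ⟨
    Z · tabulate (lookup (lookup A ρ))                      ≡⟨ cong (Z ·_) (tabulate-cong λ w → trans (lookup-columnSum ⁅ w ⁆ ρ) (·-⁅⁆ʳ (lookup A ρ) w)) ⟨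
    Z · tabulate (λ w → lookup (columnSum A ⁅ w ⁆) ρ)       ≡⟨ lookup-combine Z (λ w → columnSum A ⁅ w ⁆) ρ ⟨
    lookup (combine Z (λ w → columnSum A ⁅ w ⁆)) ρ          ∎

  combine-represents : ∀ (Z : Subset m) Y → (∀ w → columnSum A (Y w) ≡ columnSum A ⁅ w ⁆) →
                       columnSum A (combine Z Y) ≡ columnSum A Z
  combine-represents Z Y Y-sum = begin
    columnSum A (combine Z Y)                 ≡⟨ columnSum-combine Z Y ⟩
    combine Z (columnSum A ∘ Y)               ≡⟨ combine-cong Z Y-sum ⟩
    combine Z (λ w → columnSum A ⁅ w ⁆)       ≡⟨ columnSum-expand Z ⟨
    columnSum A Z                             ∎

  combine-cycle : ∀ (Z : Vec Bool k) Y → (∀ w → Cycle (Y w)) → Cycle (combine Z Y)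
  combine-cycle Z Y cycles = begin
    columnSum A (combine Z Y)      ≡⟨ columnSum-combine Z Y ⟩
    combine Z (columnSum A ∘ Y)    ≡⟨ combine-cong Z cycles ⟩
    combine Z (λ _ → 𝟎)            ≡⟨ combine-𝟎 Z ⟩
    𝟎                              ∎

  cycle-⊕ : ∀ {Z} W → Cycle Z → columnSum A (Z ⊕ W) ≡ columnSum A W
  cycle-⊕ {Z} W cyc = trans (columnSum-⊕ Z W) (trans (cong (_⊕ columnSum A W) cyc) (⊕-identityˡ _))

  ⊕-cycle : ∀ {U W} → Cycle U → Cycle W → Cycle (U ⊕ W)
  ⊕-cycle {U} {W} cycU cycW = trans (cycle-⊕ W cycU) cycW

  representation-unique : ∀ {B Y Y′} → LinIndepCols A B → Y ⊆ B → Y′ ⊆ B →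
                          columnSum A Y ≡ columnSum A Y′ → Y ≡ Y′
  representation-unique {Y = Y} {Y′} indB Y⊆B Y′⊆B eq = ⊕≡𝟎⇒≡ (indB (Y ⊕ Y′) (⊕-⊆ Y⊆B Y′⊆B) cyc)
    where cyc : Cycle (Y ⊕ Y′)
          cyc = trans (columnSum-⊕ Y Y′) (trans (cong (_⊕ columnSum A Y′) eq) (⊕-self _))

  nonzero-cycle : ∀ {X} → ¬ LinIndepCols A X → ∃ λ Z → Z ⊆ X × Cycle Z × Z ≢ ⊥
  nonzero-cycle {X} dep with anySubset? (λ Z → Z ⊆? X ×-dec ≡-dec Bool._≟_ (columnSum A Z) 𝟎 ×-dec ¬? (≡-dec Bool._≟_ Z ⊥))
  ... | yes found = found
  ... | no  none  = ⊥-elim (dep λ Z Z⊆X cyc →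
                      decidable-stable (≡-dec Bool._≟_ Z ⊥) λ Z≢⊥ → none (Z , Z⊆X , cyc , Z≢⊥))

  dependent-extension⇒represented : ∀ {B x} → LinIndepCols A B → ¬ LinIndepCols A (B ∪ ⁅ x ⁆) →
                                     ∃ (Represents B x)
  dependent-extension⇒represented {B} {x} indB dep with nonzero-cycle dep
  ... | Z , Z⊆ , cyc , Z≢⊥ with x ∈? Z
  ...   | yes x∈Z = Z ⊕ ⁅ x ⁆ , ⊕⁅⁆-⊆ Z⊆ x∈Z , cycle-⊕ ⁅ x ⁆ cyc
  ...   | no  x∉Z = ⊥-elim (Z≢⊥ (indB Z (⊆-∪⁅⁆⇒⊆ Z⊆ x∉Z) cyc))

  spanning⇒dependent-extension : ∀ {B x} → Spans B → x ∉ B → ¬ LinIndepCols A (B ∪ ⁅ x ⁆)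
  spanning⇒dependent-extension {B} {x} span x∉B indB+x with span x
  ... | Y , Y⊆B , Y-sum = nonzero (indB+x (Y ⊕ ⁅ x ⁆) sub cyc)
    where
    x∈Y⊕x : x ∈ Y ⊕ ⁅ x ⁆
    x∈Y⊕x = x∉p∧x∈q⇒x∈p⊕q Y ⁅ x ⁆ (x∉B ∘ Y⊆B) (x∈⁅x⁆ x)
    nonzero : Y ⊕ ⁅ x ⁆ ≢ ⊥
    nonzero eq = ∉⊥ (subst (x ∈_) eq x∈Y⊕x)
    sub : Y ⊕ ⁅ x ⁆ ⊆ B ∪ ⁅ x ⁆
    sub = ⊕-⊆ (p⊆p∪q ⁅ x ⁆ ∘ Y⊆B) (q⊆p∪q B ⁅ x ⁆)
    cyc : Cycle (Y ⊕ ⁅ x ⁆)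
    cyc = trans (columnSum-⊕ Y ⁅ x ⁆) (trans (cong (_⊕ columnSum A ⁅ x ⁆) Y-sum) (⊕-self _))

  exchange-linIndep : ∀ {B x e Y} → LinIndepCols A B → Represents B x Y → e ∈ Y → e ≢ x →
                      LinIndepCols A ((B - e) ∪ ⁅ x ⁆)
  exchange-linIndep {B} {x} {e} {Y} indB (Y⊆B , Y-sum) e∈Y e≢x Z Z⊆ cyc with x ∈? Z
  ... | no  x∉Z = indB Z (p─q⊆p B ⁅ e ⁆ ∘ ⊆-∪⁅⁆⇒⊆ Z⊆ x∉Z) cyc
  ... | yes x∈Z = ⊥-elim ([ e∉Z , e≢x ∘ x∈⁅y⁆⇒x≡y x ]′ (x∈p⊕q⁻ Z ⁅ x ⁆ e∈Z⊕x))
    where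
    Z⊕x⊆B-e : Z ⊕ ⁅ x ⁆ ⊆ B - e
    Z⊕x⊆B-e = ⊕⁅⁆-⊆ Z⊆ x∈Z
    Z⊕x≡Y : Z ⊕ ⁅ x ⁆ ≡ Y
    Z⊕x≡Y = representation-unique indB (p─q⊆p B ⁅ e ⁆ ∘ Z⊕x⊆B-e) Y⊆B (trans (cycle-⊕ ⁅ x ⁆ cyc) (sym Y-sum))
    e∈Z⊕x : e ∈ Z ⊕ ⁅ x ⁆
    e∈Z⊕x = subst (e ∈_) (sym Z⊕x≡Y) e∈Y
    e∉Z : e ∉ Z
    e∉Z e∈Z = x∉p-x B e (∈∪⁅⁆⇒∈ (Z⊆ e∈Z) e≢x)

  exchange-spans : ∀ {B x e Y} → Spans B → Represents B x Y → e ∈ Y → e ≢ x → Spans ((B - e) ∪ ⁅ x ⁆)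
  exchange-spans {B} {x} {e} {Y} span (Y⊆B , Y-sum) e∈Y e≢x y with span y
  ... | Y′ , Y′⊆B , Y′-sum with e ∈? Y′
  ...   | no  e∉Y′ = Y′ , (λ {f} f∈Y′ → p⊆p∪q ⁅ x ⁆ (x∈p∧x≢y⇒x∈p-y (Y′⊆B f∈Y′) λ { refl → e∉Y′ f∈Y′ })) , Y′-sum
  ...   | yes e∈Y′ = Y′ ⊕ Y ⊕ ⁅ x ⁆ , sub , sum
    where
    sub : Y′ ⊕ Y ⊕ ⁅ x ⁆ ⊆ (B - e) ∪ ⁅ x ⁆
    sub {f} f∈ with f ≟ x
    ... | yes refl = q⊆p∪q (B - e) ⁅ x ⁆ (x∈⁅x⁆ x)
    ... | no  f≢x  = p⊆p∪q ⁅ x ⁆ (x∈p∧x≢y⇒x∈p-y f∈B f≢e)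
      where
      f∈B : f ∈ B
      f∈B with x∈p⊕q⁻ Y′ (Y ⊕ ⁅ x ⁆) f∈
      ... | inj₁ f∈Y′ = Y′⊆B f∈Y′
      ... | inj₂ f∈Y⊕x = [ Y⊆B , ⊥-elim ∘ f≢x ∘ x∈⁅y⁆⇒x≡y x ]′ (x∈p⊕q⁻ Y ⁅ x ⁆ f∈Y⊕x)
      f≢e : f ≢ e
      f≢e refl = x∈p∧x∈q⇒x∉p⊕q Y′ (Y ⊕ ⁅ x ⁆) e∈Y′ (x∈p∧x∉q⇒x∈p⊕q Y ⁅ x ⁆ e∈Y (x≢y⇒x∉⁅y⁆ e≢x)) f∈
    sum : columnSum A (Y′ ⊕ Y ⊕ ⁅ x ⁆) ≡ columnSum A ⁅ y ⁆
    sum = begin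
      columnSum A (Y′ ⊕ Y ⊕ ⁅ x ⁆)                                    ≡⟨ columnSum-⊕ Y′ (Y ⊕ ⁅ x ⁆) ⟩
      columnSum A Y′ ⊕ columnSum A (Y ⊕ ⁅ x ⁆)                         ≡⟨ cong (columnSum A Y′ ⊕_) (columnSum-⊕ Y ⁅ x ⁆) ⟩
      columnSum A Y′ ⊕ columnSum A Y ⊕ columnSum A ⁅ x ⁆                ≡⟨ cong₂ (λ u v → u ⊕ v ⊕ columnSum A ⁅ x ⁆) Y′-sum Y-sum ⟩
      columnSum A ⁅ y ⁆ ⊕ columnSum A ⁅ x ⁆ ⊕ columnSum A ⁅ x ⁆         ≡⟨ cong (columnSum A ⁅ y ⁆ ⊕_) (⊕-self _) ⟩
      columnSum A ⁅ y ⁆ ⊕ 𝟎                                            ≡⟨ ⊕-identityʳ _ ⟩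
      columnSum A ⁅ y ⁆                                                ∎

-- Binary matroids

module BinaryMatroid {r} (M : Matroid m) (A : Vec (Vec Bool m) r)
                     (indep⇔ : ∀ X → Independent M X ⇔ LinIndepCols A X) where

  independent⇒linIndep : ∀ {X} → Independent M X → LinIndepCols A X
  independent⇒linIndep {X} = Equivalence.to (indep⇔ X)

  linIndep⇒independent : ∀ {X} → LinIndepCols A X → Independent M X
  linIndep⇒independent {X} = Equivalence.from (indep⇔ X)

  dependent⇒¬linIndep : ∀ {X} → Dependent M X → ¬ LinIndepCols A X
  dependent⇒¬linIndep dep lin with () ← trans (sym (linIndep⇒independent lin)) dep

  ¬linIndep⇒dependent : ∀ {X} → ¬ LinIndepCols A X → Dependent M X
  ¬linIndep⇒dependent {X} ¬lin with indep M X in eq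
  ... | true  = ⊥-elim (¬lin (independent⇒linIndep eq))
  ... | false = refl

  basis⇔ : ∀ {B} → Basis M B ⇔ (LinIndepCols A B × Spans A B)
  basis⇔ {B} = mk⇔
    (λ (indB , maximal) → independent⇒linIndep indB , span (independent⇒linIndep indB) maximal)
    (λ (lin , spans) → linIndep⇒independent lin ,
                       λ x x∉B → ¬linIndep⇒dependent (spanning⇒dependent-extension A spans x∉B))
    where
    span : LinIndepCols A B → (∀ x → x ∉ B → Dependent M (B ∪ ⁅ x ⁆)) → Spans A B
    span lin maximal x with x ∈? B
    ... | yes x∈B = ⁅ x ⁆ , singleton-⊆ x∈B , refl
    ... | no  x∉B = dependent-extension⇒represented A lin (dependent⇒¬linIndep (maximal x x∉B))

  basis? : ∀ B → Dec (Basis M B)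
  basis? B = indep M B Bool.≟ true ×-dec all? λ x → ¬? (x ∈? B) →-dec indep M (B ∪ ⁅ x ⁆) Bool.≟ false

  circuit⇒cycle : ∀ {C} → Circuit M C → Cycle A C
  circuit⇒cycle {C} (dep , minimal) with nonzero-cycle A (dependent⇒¬linIndep dep)
  ... | Z , Z⊆C , cyc , Z≢⊥ = subst (Cycle A) (⊆-antisym Z⊆C C⊆Z) cyc
    where
    C⊆Z : C ⊆ Z
    C⊆Z {x} x∈C with x ∈? Z
    ... | yes x∈Z = x∈Z
    ... | no  x∉Z = ⊥-elim (Z≢⊥ (independent⇒linIndep (minimal Z (Z⊆C , x , x∈C , x∉Z)) Z id cyc))

  module _ {D} (D-cocircuit : Cocircuit M D) where

    isolating-basis : ∀ {e} → e ∈ D → ∃ λ B → Basis M B × (∀ {f} → f ∈ B → f ∈ D → f ≡ e)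
    isolating-basis {e} e∈D with anySubset? (λ B → basis? B ×-dec ¬? (nonempty? ((D - e) ∩ B)))
    ... | yes (B , B-basis , misses) = B , B-basis , isolated
      where
      isolated : ∀ {f} → f ∈ B → f ∈ D → f ≡ e
      isolated {f} f∈B f∈D = decidable-stable (f ≟ e) λ f≢e →
        misses (f , x∈p∩q⁺ (x∈p∧x≢y⇒x∈p-y f∈D f≢e , f∈B))
    ... | no none = ⊥-elim (proj₂ D-cocircuit (D - e) (x∈p⇒p-x⊂p e∈D) meets)
      where
      meets : MeetsEveryBasis M (D - e)
      meets B B-basis = decidable-stable (nonempty? ((D - e) ∩ B)) λ misses → none (B , B-basis , misses)

    module Isolating {B e} (B-basis : Basis M B) (isolated : ∀ {f} → f ∈ B → f ∈ D → f ≡ e) where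

      private
        B-linIndep : LinIndepCols A B
        B-linIndep = proj₁ (Equivalence.to basis⇔ B-basis)

        B-spans : Spans A B
        B-spans = proj₂ (Equivalence.to basis⇔ B-basis)

      e∈D×e∈B : e ∈ D × e ∈ B
      e∈D×e∈B with proj₁ D-cocircuit B B-basis
      ... | f , f∈D∩B with x∈p∩q⁻ D B f∈D∩B
      ...   | f∈D , f∈B with isolated f∈B f∈D
      ...     | refl = f∈D , f∈B

      e∈D : e ∈ D
      e∈D = proj₁ e∈D×e∈B

      rep : Fin m → Subset m
      rep x = proj₁ (B-spans x)

      rep-⊆ : ∀ x → rep x ⊆ B
      rep-⊆ x = proj₁ (proj₂ (B-spans x))

      rep-sum : ∀ x → columnSum A (rep x) ≡ columnSum A ⁅ x ⁆
      rep-sum x = proj₂ (proj₂ (B-spans x))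

      -- If e occurred in the representation of some x ∉ D, exchanging e for x would give a basis disjoint from D.
      rep∌e : ∀ {x} → x ∉ D → lookup (rep x) e ≡ false
      rep∌e {x} x∉D with lookup (rep x) e in e∈rep
      ... | false = refl
      ... | true  = ⊥-elim (misses (proj₁ D-cocircuit B′ B′-basis))
        where
        e≢x : e ≢ x
        e≢x refl = x∉D e∈D
        B′ : Subset m
        B′ = (B - e) ∪ ⁅ x ⁆
        B′-basis : Basis M B′
        B′-basis = Equivalence.from basis⇔
          ( exchange-linIndep A B-linIndep (rep-⊆ x , rep-sum x) (lookup⇒∈ e∈rep) e≢x
          , exchange-spans A B-spans (rep-⊆ x , rep-sum x) (lookup⇒∈ e∈rep) e≢x)
        misses : ¬ Nonempty (D ∩ B′)
        misses (f , f∈D∩B′) with x∈p∩q⁻ D B′ f∈D∩B′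
        ... | f∈D , f∈B′ with x∈p∪q⁻ (B - e) ⁅ x ⁆ f∈B′
        ...   | inj₁ f∈B-e = x∉p-x B e (subst (_∈ B - e) (isolated (p─q⊆p B ⁅ e ⁆ f∈B-e) f∈D) f∈B-e)
        ...   | inj₂ f∈x   = x∉D (subst (_∈ D) (x∈⁅y⁆⇒x≡y x f∈x) f∈D)

      -- Represent e in a basis B₂ isolating x and rewrite each term in B: by rep∌e the e-coordinate vanishes.
      rep∋e : ∀ {x} → x ∈ D → lookup (rep x) e ≡ true
      rep∋e {x} x∈D with lookup (rep x) e in e∉rep-x
      ...   | true  = refl
      ...   | false with isolating-basis x∈D
      ...     | B₂ , B₂-basis , isolated₂ with proj₂ (Equivalence.to basis⇔ B₂-basis) e
      ...       | W , W⊆B₂ , W-sum = ⊥-elim (lookup⇒∉ e-coordinate (subst (e ∈_) (sym combine≡e) (x∈⁅x⁆ e)))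
        where
        combine≡e : combine W rep ≡ ⁅ e ⁆
        combine≡e = representation-unique A B-linIndep (combine-⊆ W rep rep-⊆) (singleton-⊆ (proj₂ e∈D×e∈B))
                      (trans (combine-represents A W rep rep-sum) W-sum)
        vanish : ∀ {w} → w ∈ W → lookup (rep w) e ≡ false
        vanish {w} w∈W with w ∈? D
        ... | yes w∈D = subst (λ w → lookup (rep w) e ≡ false) (sym (isolated₂ (W⊆B₂ w∈W) w∈D)) e∉rep-x
        ... | no  w∉D = rep∌e w∉D
        e-coordinate : lookup (combine W rep) e ≡ false
        e-coordinate = trans (lookup-combine W rep e)
          (·-false W _ λ w w∈W → trans (lookup∘tabulate _ w) (vanish (lookup⇒∈ w∈W)))

      rep-coordinate : tabulate (λ x → lookup (rep x) e) ≡ D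
      rep-coordinate = lookup-ext λ x → trans (lookup∘tabulate _ x) (coordinate x)
        where
        coordinate : ∀ x → lookup (rep x) e ≡ lookup D x
        coordinate x with x ∈? D
        ... | yes x∈D = trans (rep∋e x∈D) (sym (∈⇒lookup x∈D))
        ... | no  x∉D = trans (rep∌e x∉D) (sym (∉⇒lookup x∉D))

      cycle-meets-evenly : ∀ {Z} → Cycle A Z → Z · D ≡ false
      cycle-meets-evenly {Z} cyc = begin
        Z · D                                    ≡⟨ cong (Z ·_) rep-coordinate ⟨
        Z · tabulate (λ x → lookup (rep x) e)    ≡⟨ lookup-combine Z rep e ⟨
        lookup (combine Z rep) e                 ≡⟨ cong (λ Y → lookup Y e) combine≡⊥ ⟩
        lookup ⊥ e                               ≡⟨ lookup-replicate e false ⟩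
        false                                    ∎
        where
        combine≡⊥ : combine Z rep ≡ ⊥
        combine≡⊥ = B-linIndep (combine Z rep) (combine-⊆ Z rep rep-⊆) (trans (combine-represents A Z rep rep-sum) cyc)

    cocircuit-orthogonal : ∀ {Z} → Cycle A Z → Z · D ≡ false
    cocircuit-orthogonal {Z} cyc with Z · D in odd
    ... | false = refl
    ... | true with ·-true⇒∃ Z D odd
    ...   | e , _ , e∈D with isolating-basis (lookup⇒∈ e∈D)
    ...     | B , B-basis , isolated = trans (sym odd) (Isolating.cycle-meets-evenly B-basis isolated cyc)

  module _ {X Y : Subset m} {φ ψ : Fin m → Fin m} (inverses : Inverses φ ψ)
           (φ-avoids : ∀ e → e ∉ X → φ e ∉ Y) (ψ-avoids : ∀ f → f ∉ Y → ψ f ∉ X)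
           (φ-cycle : ∀ U → U ⊆ ∁ X → Cycle A U → Cycle A (image φ U))
           (ψ-cycle : ∀ V → V ⊆ ∁ Y → Cycle A V → Cycle A (image ψ V)) where

    private
      inverses⁻¹ : Inverses ψ φ
      inverses⁻¹ = proj₂ inverses , proj₁ inverses

    linIndep-image : ∀ {Z} → Z ⊆ ∁ X → LinIndepCols A Z ⇔ LinIndepCols A (image φ Z)
    linIndep-image {Z} Z⊆ = mk⇔ forward backward
      where
      forward : LinIndepCols A Z → LinIndepCols A (image φ Z)
      forward indZ W W⊆φZ cyc = begin
        W                     ≡⟨ image-inverse inverses⁻¹ W ⟨
        image φ (image ψ W)   ≡⟨ cong (image φ) (indZ (image ψ W) ψW⊆Z (ψ-cycle W W⊆∁Y cyc)) ⟩
        image φ ⊥             ≡⟨ image-⊥ ⟩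
        ⊥                     ∎
        where
        W⊆∁Y : W ⊆ ∁ Y
        W⊆∁Y = image-avoids φ-avoids Z⊆ ∘ W⊆φZ
        ψW⊆Z : image ψ W ⊆ Z
        ψW⊆Z = subst (image ψ W ⊆_) (image-inverse inverses Z) (image-mono W⊆φZ)
      backward : LinIndepCols A (image φ Z) → LinIndepCols A Z
      backward indφZ U U⊆Z cyc = begin
        U                     ≡⟨ image-inverse inverses U ⟨
        image ψ (image φ U)   ≡⟨ cong (image ψ) (indφZ (image φ U) (image-mono U⊆Z) (φ-cycle U (Z⊆ ∘ U⊆Z) cyc)) ⟩
        image ψ ⊥             ≡⟨ image-⊥ ⟩
        ⊥                     ∎

    deletionIso : DeletionIso M X Y
    deletionIso = φ , φ-avoids , injective , surjective , preserves
      where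
      injective : ∀ e e′ → e ∉ X → e′ ∉ X → φ e ≡ φ e′ → e ≡ e′
      injective e e′ _ _ eq = trans (sym (proj₁ inverses e)) (trans (cong ψ eq) (proj₁ inverses e′))
      surjective : ∀ f → f ∉ Y → ∃ λ e → e ∉ X × φ e ≡ f
      surjective f f∉Y = ψ f , ψ-avoids f f∉Y , proj₂ inverses f
      preserves : ∀ Z → Z ⊆ ∁ X → indep M Z ≡ indep M (image φ Z)
      preserves Z Z⊆ = ≡true⇔≡true⇒≡ (⇔-trans (indep⇔ Z) (⇔-trans (linIndep-image Z⊆) (⇔-sym (indep⇔ (image φ Z)))))

next-inject₁ : ∀ (i : Fin n) → next (inject₁ i) ≡ suc i
next-inject₁ {n} i = toℕ-injective (begin
  toℕ (next (inject₁ i))         ≡⟨ toℕ-fromℕ< _ ⟩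
  suc (toℕ (inject₁ i)) % suc n  ≡⟨ cong (λ t → suc t % suc n) (toℕ-inject₁ i) ⟩
  suc (toℕ i) % suc n            ≡⟨ m<n⇒m%n≡m (s≤s (toℕ<n i)) ⟩
  suc (toℕ i)                    ∎)

next-fromℕ : ∀ n → next (fromℕ n) ≡ zero
next-fromℕ n = toℕ-injective (begin
  toℕ (next (fromℕ n))           ≡⟨ toℕ-fromℕ< _ ⟩
  suc (toℕ (fromℕ n)) % suc n    ≡⟨ cong (λ t → suc t % suc n) (toℕ-fromℕ n) ⟩
  suc n % suc n                  ≡⟨ n%n≡0 (suc n) ⟩
  0                              ∎)

prev : Fin (suc n) → Fin (suc n)
prev zero    = fromℕ _
prev (suc i) = inject₁ i

next-prev : ∀ (i : Fin (suc n)) → next (prev i) ≡ i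
next-prev zero    = next-fromℕ _
next-prev (suc i) = next-inject₁ i

prev-next : ∀ (i : Fin (suc n)) → prev (next i) ≡ i
prev-next i with view i
... | ‵fromℕ     = cong prev (next-fromℕ _)
... | ‵inject₁ j = cong prev (next-inject₁ j)

next-≢ : 1 ≤ n → ∀ (i : Fin (suc n)) → next i ≢ i
next-≢ (s≤s z≤n) i with view i
... | ‵fromℕ     = λ eq → 0≢1+n (trans (cong toℕ (sym (next-fromℕ _))) (trans (cong toℕ eq) (toℕ-fromℕ _)))
... | ‵inject₁ j = λ eq → 1+n≢n (trans (cong toℕ (trans (sym (next-inject₁ j)) eq)) (toℕ-inject₁ j))

inject₁-invariant⇒constant : ∀ {A : Set} (g : Fin (suc n) → A) →
                             (∀ i → g (suc i) ≡ g (inject₁ i)) → ∀ i → g i ≡ g zero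
inject₁-invariant⇒constant         g step zero    = refl
inject₁-invariant⇒constant {suc n} g step (suc i) =
  trans (step i) (inject₁-invariant⇒constant (g ∘ inject₁) (step ∘ inject₁) i)

next-invariant⇒constant : ∀ {A : Set} (g : Fin (suc n) → A) →
                          (∀ i → g (next i) ≡ g i) → ∀ i → g i ≡ g zero
next-invariant⇒constant g step = inject₁-invariant⇒constant g λ i →
  trans (cong g (sym (next-inject₁ i))) (step (inject₁ i))

-- Rings of bowties

module DisjointFamilies {k} (a b c : Fin k → Fin m)
  (a-inj : ∀ i j → a i ≡ a j → i ≡ j) (b-inj : ∀ i j → b i ≡ b j → i ≡ j) (c-inj : ∀ i j → c i ≡ c j → i ≡ j)
  (a≢b : ∀ i j → a i ≢ b j) (a≢c : ∀ i j → a i ≢ c j) (b≢c : ∀ i j → b i ≢ c j) where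

  data Label (e : Fin m) : Set where
    is-a       : ∀ i → a i ≡ e → Label e
    is-b       : ∀ i → b i ≡ e → Label e
    is-c       : ∀ i → c i ≡ e → Label e
    unlabelled : (∀ i → a i ≢ e) → (∀ i → b i ≢ e) → (∀ i → c i ≢ e) → Label e

  label : ∀ e → Label e
  label e with any? (λ i → a i ≟ e) | any? (λ i → b i ≟ e) | any? (λ i → c i ≟ e)
  ... | yes (i , p) | _           | _           = is-a i p
  ... | no  _       | yes (i , p) | _           = is-b i p
  ... | no  _       | no  _       | yes (i , p) = is-c i p
  ... | no  ¬a      | no  ¬b      | no  ¬c      = unlabelled (λ i p → ¬a (i , p)) (λ i p → ¬b (i , p)) (λ i p → ¬c (i , p))

  twistᴸ : (Fin k → Fin k) → ∀ {e} → Label e → Fin m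
  twistᴸ σ (is-a i _)           = c i
  twistᴸ σ (is-b i _)           = b (σ i)
  twistᴸ σ (is-c i _)           = a i
  twistᴸ σ {e} (unlabelled _ _ _) = e

  twist : (Fin k → Fin k) → Fin m → Fin m
  twist σ e = twistᴸ σ (label e)

  twistᴸ-unique : ∀ σ {e} (l l′ : Label e) → twistᴸ σ l ≡ twistᴸ σ l′
  twistᴸ-unique σ (is-a i p)           (is-a j q)           = cong c (a-inj i j (trans p (sym q)))
  twistᴸ-unique σ (is-a i p)           (is-b j q)           = ⊥-elim (a≢b i j (trans p (sym q)))
  twistᴸ-unique σ (is-a i p)           (is-c j q)           = ⊥-elim (a≢c i j (trans p (sym q)))
  twistᴸ-unique σ (is-a i p)           (unlabelled ¬a _ _)  = ⊥-elim (¬a i p)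
  twistᴸ-unique σ (is-b i p)           (is-a j q)           = ⊥-elim (a≢b j i (trans q (sym p)))
  twistᴸ-unique σ (is-b i p)           (is-b j q)           = cong (b ∘ σ) (b-inj i j (trans p (sym q)))
  twistᴸ-unique σ (is-b i p)           (is-c j q)           = ⊥-elim (b≢c i j (trans p (sym q)))
  twistᴸ-unique σ (is-b i p)           (unlabelled _ ¬b _)  = ⊥-elim (¬b i p)
  twistᴸ-unique σ (is-c i p)           (is-a j q)           = ⊥-elim (a≢c j i (trans q (sym p)))
  twistᴸ-unique σ (is-c i p)           (is-b j q)           = ⊥-elim (b≢c j i (trans q (sym p)))
  twistᴸ-unique σ (is-c i p)           (is-c j q)           = cong a (c-inj i j (trans p (sym q)))
  twistᴸ-unique σ (is-c i p)           (unlabelled _ _ ¬c)  = ⊥-elim (¬c i p)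
  twistᴸ-unique σ (unlabelled ¬a _ _)  (is-a j q)           = ⊥-elim (¬a j q)
  twistᴸ-unique σ (unlabelled _ ¬b _)  (is-b j q)           = ⊥-elim (¬b j q)
  twistᴸ-unique σ (unlabelled _ _ ¬c)  (is-c j q)           = ⊥-elim (¬c j q)
  twistᴸ-unique σ (unlabelled _ _ _)   (unlabelled _ _ _)   = refl

  twist-label : ∀ σ {e} (l : Label e) → twist σ e ≡ twistᴸ σ l
  twist-label σ = twistᴸ-unique σ (label _)

  twist-inverse : ∀ {σ τ} → (∀ i → τ (σ i) ≡ i) → ∀ e → twist τ (twist σ e) ≡ e
  twist-inverse {σ} {τ} τσ e with label e
  ... | is-a i refl = twist-label τ (is-c i refl)
  ... | is-b i refl = trans (twist-label τ (is-b (σ i) refl)) (cong b (τσ i))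
  ... | is-c i refl = twist-label τ (is-a i refl)
  ... | unlabelled ¬a ¬b ¬c = twist-label τ (unlabelled ¬a ¬b ¬c)

  twist-avoids-a : ∀ σ {e} → e ∉ imageSet c → twist σ e ∉ imageSet a
  twist-avoids-a σ {e} e∉C e′∈A with label e | Equivalence.to ∈imageSet⇔ e′∈A
  ... | is-a i refl        | j , aj≡ci    = a≢c j i aj≡ci
  ... | is-b i refl        | j , aj≡bσi   = a≢b j (σ i) aj≡bσi
  ... | is-c i refl        | _            = e∉C (Equivalence.from ∈imageSet⇔ (i , refl))
  ... | unlabelled ¬a _ _  | j , aj≡e     = ¬a j aj≡e

  twist-avoids-c : ∀ σ {e} → e ∉ imageSet a → twist σ e ∉ imageSet c
  twist-avoids-c σ {e} e∉A e′∈C with label e | Equivalence.to ∈imageSet⇔ e′∈C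
  ... | is-a i refl        | _            = e∉A (Equivalence.from ∈imageSet⇔ (i , refl))
  ... | is-b i refl        | j , cj≡bσi   = b≢c (σ i) j (sym cj≡bσi)
  ... | is-c i refl        | j , cj≡ai    = a≢c i j (sym cj≡ai)
  ... | unlabelled _ _ ¬c  | j , cj≡e     = ¬c j cj≡e

  triangle : Fin k → Subset m
  triangle i = set3 (a i) (b i) (c i)

  triangle-disjoint : ∀ {f i j} → f ∈ triangle i → f ∈ triangle j → i ≡ j
  triangle-disjoint {i = i} {j} f∈Δi f∈Δj with set3-∈⁻ f∈Δi | set3-∈⁻ f∈Δj
  ... | inj₁ p        | inj₁ q        = a-inj i j (trans p (sym q))
  ... | inj₁ p        | inj₂ (inj₁ q) = ⊥-elim (a≢b i j (trans p (sym q)))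
  ... | inj₁ p        | inj₂ (inj₂ q) = ⊥-elim (a≢c i j (trans p (sym q)))
  ... | inj₂ (inj₁ p) | inj₁ q        = ⊥-elim (a≢b j i (trans q (sym p)))
  ... | inj₂ (inj₁ p) | inj₂ (inj₁ q) = b-inj i j (trans p (sym q))
  ... | inj₂ (inj₁ p) | inj₂ (inj₂ q) = ⊥-elim (b≢c i j (trans p (sym q)))
  ... | inj₂ (inj₂ p) | inj₁ q        = ⊥-elim (a≢c j i (trans q (sym p)))
  ... | inj₂ (inj₂ p) | inj₂ (inj₁ q) = ⊥-elim (b≢c j i (trans q (sym p)))
  ... | inj₂ (inj₂ p) | inj₂ (inj₂ q) = c-inj i j (trans p (sym q))

  a∈triangle : ∀ i → a i ∈ triangle i
  a∈triangle i = x∈p∪q⁺ (inj₁ (x∈⁅x⁆ (a i)))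

  b∈triangle : ∀ i → b i ∈ triangle i
  b∈triangle i = x∈p∪q⁺ (inj₂ (x∈p∪q⁺ (inj₁ (x∈⁅x⁆ (b i)))))

  c∈triangle : ∀ i → c i ∈ triangle i
  c∈triangle i = x∈p∪q⁺ (inj₂ (x∈p∪q⁺ (inj₂ (x∈⁅x⁆ (c i)))))

  unlabelled-∉triangle : ∀ {f} → (∀ i → a i ≢ f) → (∀ i → b i ≢ f) → (∀ i → c i ≢ f) → ∀ i → f ∉ triangle i
  unlabelled-∉triangle ¬a ¬b ¬c i f∈Δi = [ ¬a i , [ ¬b i , ¬c i ]′ ]′ (set3-∈⁻ f∈Δi)

  lookup-combine-triangle : ∀ (g : Vec Bool k) {f j} → f ∈ triangle j → lookup (combine g triangle) f ≡ lookup g j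
  lookup-combine-triangle g {f} {j} f∈Δj = begin
    lookup (combine g triangle) f                 ≡⟨ lookup-combine g triangle f ⟩
    g · tabulate (λ i → lookup (triangle i) f)    ≡⟨ cong (g ·_) (lookup-ext column) ⟩
    g · ⁅ j ⁆                              ≡⟨ ·-⁅⁆ʳ g j ⟩
    lookup g j                             ∎
    where
    column : ∀ i → lookup (tabulate (λ i → lookup (triangle i) f)) i ≡ lookup ⁅ j ⁆ i
    column i = trans (lookup∘tabulate _ i) (∈⇔∈⇒lookup≡ (mk⇔
      (λ f∈Δi → Equivalence.from x∈⁅y⁆⇔x≡y (triangle-disjoint f∈Δi f∈Δj))
      (λ i∈j → subst (λ i → f ∈ triangle i) (sym (x∈⁅y⁆⇒x≡y j i∈j)) f∈Δj)))

  lookup-combine-triangle-outside : ∀ (g : Vec Bool k) {f} → (∀ i → f ∉ triangle i) → lookup (combine g triangle) f ≡ false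
  lookup-combine-triangle-outside g {f} f∉triangle = trans (lookup-combine g triangle f)
    (·-false g _ λ i _ → trans (lookup∘tabulate _ i) (∉⇒lookup (f∉triangle i)))

module BowtieRing {r} (M : Matroid m) (A : Vec (Vec Bool m) r)
  (indep⇔ : ∀ X → Independent M X ⇔ LinIndepCols A X)
  {n} (a b c : Fin (suc n) → Fin m) (1≤n : 1 ≤ n)
  (a-inj : ∀ i j → a i ≡ a j → i ≡ j) (b-inj : ∀ i j → b i ≡ b j → i ≡ j) (c-inj : ∀ i j → c i ≡ c j → i ≡ j)
  (a≢b : ∀ i j → a i ≢ b j) (a≢c : ∀ i j → a i ≢ c j) (b≢c : ∀ i j → b i ≢ c j)
  (triangles : ∀ i → Triangle M (set3 (a i) (b i) (c i)))
  (cocircuits : ∀ j → Cocircuit M (set4 (b j) (c j) (a (next j)) (b (next j)))) where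

  open BinaryMatroid M A indep⇔
  open DisjointFamilies a b c a-inj b-inj c-inj a≢b a≢c b≢c

  bowtie-parity : ∀ {Z} → Cycle A Z → ∀ j →
    lookup Z (b j) xor lookup Z (c j) xor lookup Z (a (next j)) xor lookup Z (b (next j)) ≡ false
  bowtie-parity {Z} cyc j = trans (sym (·-set4 Z (b≢c j j) (λ eq → a≢b (next j) j (sym eq))
                                          (λ eq → next-≢ 1≤n j (b-inj (next j) j (sym eq)))
                                          (λ eq → a≢c (next j) j (sym eq)) (λ eq → b≢c (next j) j (sym eq))
                                          (a≢b (next j) (next j))))
                                  (cocircuit-orthogonal (cocircuits j) cyc)

  b-coordinates-constant : ∀ {Z} → Cycle A Z → Z ⊆ imageSet b → ∀ i → lookup Z (b i) ≡ lookup Z (b zero)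
  b-coordinates-constant {Z} cyc Z⊆B = next-invariant⇒constant (lookup Z ∘ b) λ j →
    sym (xor≡false⇒≡ (subst₂ (λ u v → lookup Z (b j) xor u xor v xor lookup Z (b (next j)) ≡ false)
                              (∉⇒lookup (c∉B j ∘ Z⊆B)) (∉⇒lookup (a∉B (next j) ∘ Z⊆B)) (bowtie-parity cyc j)))
    where
    c∉B : ∀ j → c j ∉ imageSet b
    c∉B j cj∈B = let i , bi≡cj = Equivalence.to ∈imageSet⇔ cj∈B in b≢c i j bi≡cj
    a∉B : ∀ j → a j ∉ imageSet b
    a∉B j aj∈B = let i , bi≡aj = Equivalence.to ∈imageSet⇔ aj∈B in a≢b j i (sym bi≡aj)

  cycle-in-b-empty-or-full : ∀ {Z} → Cycle A Z → Z ⊆ imageSet b → Z ≡ ⊥ ⊎ imageSet b ⊆ Z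
  cycle-in-b-empty-or-full {Z} cyc Z⊆B with lookup Z (b zero) in Zb₀
  ... | false = inj₁ (Empty-unique λ (f , f∈Z) → absent (Z⊆B f∈Z) f∈Z)
    where
    absent : ∀ {f} → f ∈ imageSet b → f ∉ Z
    absent f∈B with Equivalence.to (∈imageSet⇔ {f = b}) f∈B
    ... | i , refl = lookup⇒∉ (trans (b-coordinates-constant cyc Z⊆B i) Zb₀)
  ... | true = inj₂ present
    where
    present : imageSet b ⊆ Z
    present f∈B with Equivalence.to (∈imageSet⇔ {f = b}) f∈B
    ... | i , refl = lookup⇒∈ (trans (b-coordinates-constant cyc Z⊆B i) Zb₀)

  b-circuit-or-independent : Circuit M (imageSet b) ⊎ Independent M (imageSet b)
  b-circuit-or-independent with indep M (imageSet b)
  ... | true  = inj₂ refl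
  ... | false = inj₁ (refl , λ Y Y⊂B → linIndep⇒independent (proper-linIndep Y⊂B))
    where
    proper-linIndep : ∀ {Y} → Y ⊂ imageSet b → LinIndepCols A Y
    proper-linIndep (Y⊆B , x , x∈B , x∉Y) Z Z⊆Y cyc =
      [ id , (λ B⊆Z → ⊥-elim (x∉Y (Z⊆Y (B⊆Z x∈B)))) ]′ (cycle-in-b-empty-or-full cyc (Y⊆B ∘ Z⊆Y))

  φ ψ : Fin m → Fin m
  φ = twist next
  ψ = twist prev

  φψ-inverses : Inverses φ ψ
  φψ-inverses = twist-inverse prev-next , twist-inverse next-prev

  triangle-cycles : ∀ (g : Vec Bool (suc n)) → Cycle A (combine g triangle)
  triangle-cycles g = combine-cycle A g triangle (circuit⇒cycle ∘ proj₁ ∘ triangles)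

  φ-cycle : ∀ U → U ⊆ ∁ (imageSet c) → Cycle A U → Cycle A (image φ U)
  φ-cycle U U⊆ cyc = subst (Cycle A) (sym image≡) (⊕-cycle A cyc (triangle-cycles g))
    where
    g : Vec Bool (suc n)
    g = tabulate (λ i → lookup U (a i))
    Uc≡false : ∀ j → lookup U (c j) ≡ false
    Uc≡false j = ⊆∁⇒lookup U⊆ (Equivalence.from ∈imageSet⇔ (j , refl))
    combine-at : ∀ {f j} → f ∈ triangle j → lookup (combine g triangle) f ≡ lookup U (a j)
    combine-at f∈ = trans (lookup-combine-triangle g f∈) (lookup∘tabulate (lookup U ∘ a) _)
    -- Matching on label f also reduces ψ f, so each case starts from the image element.
    at : ∀ f → lookup U (ψ f) ≡ lookup U f xor lookup (combine g triangle) f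
    at f with label f
    ... | is-a j refl = begin
      lookup U (c j)                                         ≡⟨ Uc≡false j ⟩
      false                                                  ≡⟨ xor-same (lookup U (a j)) ⟨
      lookup U (a j) xor lookup U (a j)                      ≡⟨ cong (lookup U (a j) xor_) (combine-at (a∈triangle j)) ⟨
      lookup U (a j) xor lookup (combine g triangle) (a j)   ∎
    ... | is-b j refl = begin
      lookup U (b (prev j))                                  ≡⟨ xor≡false⇒≡ parity ⟩
      lookup U (a j) xor lookup U (b j)                      ≡⟨ xor-comm (lookup U (a j)) (lookup U (b j)) ⟩
      lookup U (b j) xor lookup U (a j)                      ≡⟨ cong (lookup U (b j) xor_) (combine-at (b∈triangle j)) ⟨
      lookup U (b j) xor lookup (combine g triangle) (b j)   ∎
      where
      parity : lookup U (b (prev j)) xor lookup U (a j) xor lookup U (b j) ≡ false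
      parity = subst₂ (λ u j′ → lookup U (b (prev j)) xor u xor lookup U (a j′) xor lookup U (b j′) ≡ false)
                      (Uc≡false (prev j)) (next-prev j) (bowtie-parity cyc (prev j))
    ... | is-c j refl = begin
      lookup U (a j)                                         ≡⟨ cong (_xor lookup U (a j)) (Uc≡false j) ⟨
      lookup U (c j) xor lookup U (a j)                      ≡⟨ cong (lookup U (c j) xor_) (combine-at (c∈triangle j)) ⟨
      lookup U (c j) xor lookup (combine g triangle) (c j)   ∎
    ... | unlabelled ¬a ¬b ¬c = begin
      lookup U f                                             ≡⟨ xor-identityʳ (lookup U f) ⟨
      lookup U f xor false                                   ≡⟨ cong (lookup U f xor_) (lookup-combine-triangle-outside g (unlabelled-∉triangle ¬a ¬b ¬c)) ⟨
      lookup U f xor lookup (combine g triangle) f           ∎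
    image≡ : image φ U ≡ U ⊕ combine g triangle
    image≡ = lookup-ext λ f → trans (∈⇔∈⇒lookup≡ (∈image-inverse⇔ {φ = φ} φψ-inverses {U})) (trans (at f) (sym (lookup-⊕ U _ f)))

  ψ-cycle : ∀ V → V ⊆ ∁ (imageSet a) → Cycle A V → Cycle A (image ψ V)
  ψ-cycle V V⊆ cyc = subst (Cycle A) (sym image≡) (⊕-cycle A cyc (triangle-cycles g))
    where
    g : Vec Bool (suc n)
    g = tabulate (λ i → lookup V (c i))
    Va≡false : ∀ j → lookup V (a j) ≡ false
    Va≡false j = ⊆∁⇒lookup V⊆ (Equivalence.from ∈imageSet⇔ (j , refl))
    combine-at : ∀ {f j} → f ∈ triangle j → lookup (combine g triangle) f ≡ lookup V (c j)
    combine-at f∈ = trans (lookup-combine-triangle g f∈) (lookup∘tabulate (lookup V ∘ c) _)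
    at : ∀ f → lookup V (φ f) ≡ lookup V f xor lookup (combine g triangle) f
    at f with label f
    ... | is-a j refl = begin
      lookup V (c j)                                         ≡⟨ cong (_xor lookup V (c j)) (Va≡false j) ⟨
      lookup V (a j) xor lookup V (c j)                      ≡⟨ cong (lookup V (a j) xor_) (combine-at (a∈triangle j)) ⟨
      lookup V (a j) xor lookup (combine g triangle) (a j)   ∎
    ... | is-b j refl = begin
      lookup V (b (next j))                                  ≡⟨ xor≡false⇒≡ parity ⟨
      lookup V (b j) xor lookup V (c j)                      ≡⟨ cong (lookup V (b j) xor_) (combine-at (b∈triangle j)) ⟨
      lookup V (b j) xor lookup (combine g triangle) (b j)   ∎
      where
      parity : (lookup V (b j) xor lookup V (c j)) xor lookup V (b (next j)) ≡ false
      parity = trans (xor-assoc (lookup V (b j)) (lookup V (c j)) _)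
                 (subst (λ u → lookup V (b j) xor lookup V (c j) xor u xor lookup V (b (next j)) ≡ false)
                        (Va≡false (next j)) (bowtie-parity cyc j))
    ... | is-c j refl = begin
      lookup V (a j)                                         ≡⟨ Va≡false j ⟩
      false                                                  ≡⟨ xor-same (lookup V (c j)) ⟨
      lookup V (c j) xor lookup V (c j)                      ≡⟨ cong (lookup V (c j) xor_) (combine-at (c∈triangle j)) ⟨
      lookup V (c j) xor lookup (combine g triangle) (c j)   ∎
    ... | unlabelled ¬a ¬b ¬c = begin
      lookup V f                                             ≡⟨ xor-identityʳ (lookup V f) ⟨
      lookup V f xor false                                   ≡⟨ cong (lookup V f xor_) (lookup-combine-triangle-outside g (unlabelled-∉triangle ¬a ¬b ¬c)) ⟨
      lookup V f xor lookup (combine g triangle) f           ∎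
    image≡ : image ψ V ≡ V ⊕ combine g triangle
    image≡ = lookup-ext λ f → trans (∈⇔∈⇒lookup≡ (∈image-inverse⇔ {φ = ψ} (proj₂ φψ-inverses , proj₁ φψ-inverses) {V}))
                                    (trans (at f) (sym (lookup-⊕ V _ f)))

  c-deletion≅a-deletion : DeletionIso M (imageSet c) (imageSet a)
  c-deletion≅a-deletion = deletionIso φψ-inverses (λ _ → twist-avoids-a next) (λ _ → twist-avoids-c prev) φ-cycle ψ-cycle

lemma5p6 : ∀ {m} (M : Matroid m) → Binary M → InternallyFourConnected M →
    (n : ℕ) (a b c : Fin (suc n) → Fin m) → RingOfBowties M n a b c →
    (Circuit M (imageSet b) ⊎ Independent M (imageSet b)) ×
    DeletionIso M (imageSet c) (imageSet a)
lemma5p6 M (_ , A , indep⇔) _ n a b c (2≤n , a-inj , b-inj , c-inj , a≢b , a≢c , b≢c , triangles , cocircuits) =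
  b-circuit-or-independent , c-deletion≅a-deletion
  where open BowtieRing M A indep⇔ a b c (≤-trans (s≤s z≤n) 2≤n) a-inj b-inj c-inj a≢b a≢c b≢c triangles cocircuits
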